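{- For every integer $n\geq 1$, the number of set partitions $\Pi$ of $[n]$ such that $\mathrm{Flatten}(\Pi)$ avoids the pattern $132$ is $2^{n-1}$.
   Context: A set partition $\Pi$ of $[n]=\{1,\dots,n\}$ is written in standard increasing form: the entries within each block are listed in increasing order, and the blocks are listed in increasing order of their smallest (first) entries. $\mathrm{Flatten}(\Pi)$ is the permutation of $[n]$ (in one-line notation) obtained by concatenating the blocks of $\Pi$ written in this standard increasing form; e.g. $\Pi = 136\text{ - }279\text{ - }4\text{ - }58$ gives $\mathrm{Flatten}(\Pi)=136279458$. A permutation $p=p_1\cdots p_n$ avoids a pattern $\pi=\pi_1\cdots\pi_m$ (a permutation of $[m]$) if there are no indices $i_1<\dots<i_m$ such that $p_{i_1},\dots,p_{i_m}$ are in the same relative order as $\pi_1,\dots,\pi_m$. -}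

module Defs where

open import Data.Nat using (ℕ; zero; suc; _<_)
open import Data.List using (List; []; _∷_; length; concat; map; upTo; lookup)
open import Data.List.Relation.Unary.All using (All)
open import Data.List.Relation.Binary.Permutation.Propositional using (_↭_)
open import Data.List.Relation.Unary.Linked using (Linked)
open import Data.Fin using (Fin) renaming (_<_ to _<ᶠ_)
open import Data.Product using (Σ; _×_)
open import Function.Bundles using (_⇔_)
open import Relation.Nullary using (¬_)

oneTo : ℕ → List ℕ
oneTo n = map suc (upTo n)

-- A block written in increasing form.
Block : Set
Block = List ℕ

Blocks : Set
Blocks = List Block

data NonEmpty : Block → Set where
  nonEmpty : ∀ {x xs} → NonEmpty (x ∷ xs)

data FirstLess : Block → Block → Set where
  firstLess : ∀ {x xs y ys} → x < y → FirstLess (x ∷ xs) (y ∷ ys)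

record IsStdPartition (n : ℕ) (bs : Blocks) : Set where
  field
    nonempty   : All NonEmpty bs
    increasing : All (Linked _<_) bs
    ordered    : Linked FirstLess bs
    covers     : concat bs ↭ oneTo n

flatten : Blocks → List ℕ
flatten = concat

Contains : List ℕ → List ℕ → Set
Contains p π =
  Σ (Fin (length π) → Fin (length p)) λ f →
    (∀ a b → a <ᶠ b → f a <ᶠ f b) ×
    (∀ a b → (lookup π a < lookup π b) ⇔ (lookup p (f a) < lookup p (f b)))

Avoids : List ℕ → List ℕ → Set
Avoids p π = ¬ Contains p π

pattern132 : List ℕ
pattern132 = 1 ∷ 3 ∷ 2 ∷ []

module Submission where

-- Set partitions of [n] whose flattening avoids 132 are exactly the
-- "segmentations" of the list 1 2 … n into consecutive nonempty blocks,
-- and there are 2^(n-1) of these (one cut/no-cut choice between each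
-- pair of neighbours).
--
-- In a standard partition the first entry of Flatten(Π)
-- is smaller than every later entry; an entry x that lies below everything
-- after it forms a 132 together with any descent b < a occurring later, so
-- when Flatten(Π) avoids 132 the whole of Flatten(Π) is weakly increasing.
-- Being a rearrangement of 1 2 … n it is then equal to 1 2 … n.  Conversely
-- every list of nonempty blocks concatenating to 1 2 … n is a standard
-- partition, and its flattening is increasing, hence avoids 132.
--
-- Segmentations of x ∷ xs are enumerated without repetition by
-- the list of "splits" of xs (an open initial block followed by closed
-- blocks), built by deciding for every element whether it closes a block;
-- this list has length 2^|xs|.

open import Defs
open import Data.Nat using (ℕ; _≤_; _^_; _∸_)
open import Data.List using (List; length)
open import Data.List.Relation.Unary.Unique.Propositional using (Unique)
open import Data.List.Membership.Propositional using (_∈_)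
open import Data.Product using (Σ; _×_)
open import Function.Bundles using (_⇔_)
open import Relation.Binary.PropositionalEquality using (_≡_)

open import Data.Nat using (suc; _<_; _+_; z≤n; s≤s)
open import Data.Nat.Properties
  using (<-trans; <-asym; <-irrefl; n<1+n; <⇒≤; ≮⇒≥; <⇒≯; ≤⇒≯; ≤-totalOrder; +-identityʳ)
open import Data.List using ([]; _∷_; _++_; map; concat; applyUpTo; lookup)
open import Data.List.Properties using (length-++; length-map; length-applyUpTo; ∷-injective)
open import Data.List.Relation.Unary.All as All using (All; []; _∷_)
import Data.List.Relation.Unary.All.Properties as All
open import Data.List.Relation.Unary.AllPairs using (AllPairs; []; _∷_)
open import Data.List.Relation.Unary.Linked as Linked using (Linked; []; [-]; _∷_)
import Data.List.Relation.Unary.Linked.Properties as Linked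
open import Data.List.Relation.Unary.Any using (here)
import Data.List.Relation.Unary.Unique.Propositional.Properties as Unique
open import Data.List.Membership.Propositional.Properties
  using (∈-map⁺; ∈-map⁻; ∈-++⁺ˡ; ∈-++⁺ʳ; ∈-++⁻; ∈-lookup)
open import Data.List.Relation.Binary.Permutation.Propositional using (_↭_; ↭-reflexive; ↭⇒↭ₛ)
open import Data.List.Relation.Unary.Sorted.TotalOrder.Properties using (↗↭↗⇒≋)
open import Data.List.Relation.Binary.Pointwise using (Pointwise-≡⇒≡)
open import Data.Fin using (Fin) renaming (zero to fz; suc to fs; _<_ to _<ᶠ_)
open import Data.Product using (_,_; proj₂)
open import Data.Sum using (inj₁; inj₂)
open import Data.Empty using (⊥-elim)
open import Function.Bundles using (mk⇔; Equivalence)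
open import Function.Properties.Equivalence using () renaming (trans to ⇔-trans; sym to ⇔-sym)
open import Relation.Nullary using (¬_)
open import Relation.Binary.PropositionalEquality using (refl; sym; trans; cong; cong₂; subst; module ≡-Reasoning)
open ≡-Reasoning

lookup-increasing : ∀ {p} → AllPairs _<_ p →
                    ∀ i j → i <ᶠ j → lookup p i < lookup p j
lookup-increasing (p<r ∷ _) fz (fs j) _ = All.lookup p<r (∈-lookup j)
lookup-increasing (_ ∷ ap) (fs i) (fs j) (s≤s i<j) = lookup-increasing ap i j i<j

-- A strictly increasing list has no occurrence of 132: the entries matched
-- with "3" and "2" would have to be both increasing and decreasing.
increasing⇒avoids132 : ∀ {p} → Linked _<_ p → Avoids p pattern132
increasing⇒avoids132 inc (f , f-mono , f-order) =
  <-asym (lookup-increasing (Linked.Linked⇒AllPairs <-trans inc) (f three) (f two)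
            (f-mono three two (s≤s (s≤s z≤n))))
         (Equivalence.to (f-order two three) (s≤s (s≤s (s≤s z≤n))))
  where
  three two : Fin 3
  three = fs fz
  two   = fs (fs fz)

both-hold : ∀ {A B : Set} → A → B → A ⇔ B
both-hold a b = mk⇔ (λ _ → b) (λ _ → a)

both-fail : ∀ {A B : Set} → ¬ A → ¬ B → A ⇔ B
both-fail ¬a ¬b = mk⇔ (λ a → ⊥-elim (¬a a)) (λ b → ⊥-elim (¬b b))

descent⇒132 : ∀ {x q} {i j : Fin (length q)} → All (x <_) q →
              i <ᶠ j → lookup q j < lookup q i → Contains (x ∷ q) pattern132
descent⇒132 {x} {q} {i} {j} x<q i<j desc = f , f-mono , f-order
  where
  x<qi : x < lookup q i
  x<qi = All.lookup x<q (∈-lookup i)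
  x<qj : x < lookup q j
  x<qj = All.lookup x<q (∈-lookup j)

  f : Fin 3 → Fin (length (x ∷ q))
  f fz           = fz
  f (fs fz)      = fs i
  f (fs (fs fz)) = fs j

  f-mono : ∀ a b → a <ᶠ b → f a <ᶠ f b
  f-mono fz           (fs fz)      _ = s≤s z≤n
  f-mono fz           (fs (fs fz)) _ = s≤s z≤n
  f-mono (fs fz)      (fs (fs fz)) _ = s≤s i<j
  f-mono (fs fz)      (fs fz)      (s≤s ())
  f-mono (fs (fs fz)) (fs fz)      (s≤s ())
  f-mono (fs (fs fz)) (fs (fs fz)) (s≤s (s≤s ()))

  f-order : ∀ a b → (lookup pattern132 a < lookup pattern132 b)
                  ⇔ (lookup (x ∷ q) (f a) < lookup (x ∷ q) (f b))
  f-order fz           fz           = both-fail (<-irrefl refl) (<-irrefl refl)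
  f-order fz           (fs fz)      = both-hold (s≤s (s≤s z≤n)) x<qi
  f-order fz           (fs (fs fz)) = both-hold (s≤s (s≤s z≤n)) x<qj
  f-order (fs fz)      fz           = both-fail (≤⇒≯ (s≤s z≤n)) (<⇒≯ x<qi)
  f-order (fs fz)      (fs fz)      = both-fail (<-irrefl refl) (<-irrefl refl)
  f-order (fs fz)      (fs (fs fz)) = both-fail (≤⇒≯ (s≤s (s≤s z≤n))) (<⇒≯ desc)
  f-order (fs (fs fz)) fz           = both-fail (≤⇒≯ (s≤s z≤n)) (<⇒≯ x<qj)
  f-order (fs (fs fz)) (fs fz)      = both-hold (s≤s (s≤s (s≤s z≤n))) desc
  f-order (fs (fs fz)) (fs (fs fz)) = both-fail (<-irrefl refl) (<-irrefl refl)

pairwise⇒sorted : ∀ q → (∀ i j → i <ᶠ j → lookup q i ≤ lookup q j) → Linked _≤_ q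
pairwise⇒sorted []          _ = []
pairwise⇒sorted (a ∷ [])    _ = [-]
pairwise⇒sorted (a ∷ b ∷ r) h =
  h fz (fs fz) (s≤s z≤n) ∷ pairwise⇒sorted (b ∷ r) (λ i j i<j → h (fs i) (fs j) (s≤s i<j))

avoids132⇒sorted : ∀ {x} q → All (x <_) q → Avoids (x ∷ q) pattern132 → Linked _≤_ q
avoids132⇒sorted q x<q avoids =
  pairwise⇒sorted q (λ i j i<j → ≮⇒≥ (λ desc → avoids (descent⇒132 x<q i<j desc)))

sorted-cons : ∀ {x q} → All (x <_) q → Linked _≤_ q → Linked _≤_ (x ∷ q)
sorted-cons []          _      = [-]
sorted-cons (x<a ∷ _)   sorted = <⇒≤ x<a ∷ sorted

oneTo-increasing : ∀ n → Linked _<_ (oneTo n)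
oneTo-increasing n = Linked.map⁺ (Linked.applyUpTo⁺₂ (λ i → i) n (λ i → n<1+n (suc i)))

sorted-rearrangement : ∀ {n xs} → Linked _≤_ xs → xs ↭ oneTo n → xs ≡ oneTo n
sorted-rearrangement {n} sorted xs↭ =
  Pointwise-≡⇒≡ (↗↭↗⇒≋ ≤-totalOrder sorted
                   (Linked.map <⇒≤ (oneTo-increasing n)) (↭⇒↭ₛ xs↭))

IsSegmentation : List ℕ → Blocks → Set
IsSegmentation xs bs = All NonEmpty bs × concat bs ≡ xs

AllPairs-++⁻ : ∀ {A : Set} {R : A → A → Set} xs {ys} →
               AllPairs R (xs ++ ys) → AllPairs R xs × AllPairs R ys
AllPairs-++⁻ []       ap         = [] , ap
AllPairs-++⁻ (x ∷ xs) (x~ ∷ ap) with AllPairs-++⁻ xs ap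
... | apˡ , apʳ = All.++⁻ˡ xs x~ ∷ apˡ , apʳ

blocks-increasing : ∀ bs → AllPairs _<_ (concat bs) → All (AllPairs _<_) bs
blocks-increasing []       _  = []
blocks-increasing (b ∷ bs) ap with AllPairs-++⁻ b ap
... | apᵇ , apᵇˢ = apᵇ ∷ blocks-increasing bs apᵇˢ

firsts-increasing : ∀ bs → All NonEmpty bs → AllPairs _<_ (concat bs) → Linked FirstLess bs
firsts-increasing []                             _                  _ = []
firsts-increasing (b ∷ [])                       _                  _ = [-]
firsts-increasing ((x ∷ c) ∷ (y ∷ d) ∷ rest) (_ ∷ ne) (x<later ∷ ap) =
  firstLess (All.lookup x<later (∈-++⁺ʳ c (here refl)))
  ∷ firsts-increasing ((y ∷ d) ∷ rest) ne (proj₂ (AllPairs-++⁻ c ap))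
firsts-increasing (_ ∷ [] ∷ _) (_ ∷ () ∷ _) _

segmentation⇒avoiding : ∀ n bs → IsSegmentation (oneTo n) bs →
                        IsStdPartition n bs × Avoids (flatten bs) pattern132
segmentation⇒avoiding n bs (ne , bs≡) =
  record { nonempty   = ne
         ; increasing = All.map Linked.AllPairs⇒Linked (blocks-increasing bs ap)
         ; ordered    = firsts-increasing bs ne ap
         ; covers     = ↭-reflexive bs≡ }
  , increasing⇒avoids132 inc
  where
  inc : Linked _<_ (concat bs)
  inc = subst (Linked _<_) (sym bs≡) (oneTo-increasing n)
  ap : AllPairs _<_ (concat bs)
  ap = Linked.Linked⇒AllPairs <-trans inc

head-below : ∀ {x b} → Linked _<_ (x ∷ b) → All (x <_) b
head-below inc with Linked.Linked⇒AllPairs <-trans inc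
... | x<b ∷ _ = x<b

first-below-later : ∀ {x d cs} → Linked FirstLess ((x ∷ d) ∷ cs) →
                    All (Linked _<_) cs → All (x <_) (concat cs)
first-below-later {cs = []}           _                        _ = []
first-below-later {cs = (y ∷ c) ∷ cs} (firstLess x<y ∷ ordered) (inc ∷ incs) =
  x<y ∷ All.++⁺ (All.map (<-trans x<y) (head-below inc))
                (All.map (<-trans x<y) (first-below-later ordered incs))

-- In a standard partition the flattening starts with its minimum; if it
-- avoids 132 it is therefore weakly increasing.
flatten-sorted : ∀ {n} bs → IsStdPartition n bs → Avoids (flatten bs) pattern132 →
                 Linked _≤_ (flatten bs)
flatten-sorted []               _   _       = []
flatten-sorted ([] ∷ cs)        std _       with IsStdPartition.nonempty std
... | () ∷ _
flatten-sorted ((x ∷ b) ∷ cs)   std avoids  = sorted-cons x<rest (avoids132⇒sorted _ x<rest avoids)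
  where
  open IsStdPartition std
  x<rest : All (x <_) (b ++ concat cs)
  x<rest with increasing
  ... | inc ∷ incs = All.++⁺ (head-below inc) (first-below-later ordered incs)

avoiding⇒segmentation : ∀ n bs → IsStdPartition n bs → Avoids (flatten bs) pattern132 →
                        IsSegmentation (oneTo n) bs
avoiding⇒segmentation n bs std avoids =
  IsStdPartition.nonempty std ,
  sorted-rearrangement (flatten-sorted bs std avoids) (IsStdPartition.covers std)

-- A split of xs: an open initial block b followed by closed nonempty blocks
-- bs, with b ++ concat bs ≡ xs.
Split : Set
Split = Block × Blocks

IsSplit : List ℕ → Split → Set
IsSplit xs (b , bs) = All NonEmpty bs × b ++ concat bs ≡ xs

-- The two ways to extend a split of ys to one of y ∷ ys: y joins the open
-- block and closes it, or y joins the open block and keeps it open.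
close-with : ℕ → Split → Split
close-with y (b , bs) = [] , (y ∷ b) ∷ bs

extend-with : ℕ → Split → Split
extend-with y (b , bs) = y ∷ b , bs

splits : List ℕ → List Split
splits []       = ([] , []) ∷ []
splits (y ∷ ys) = map (close-with y) (splits ys) ++ map (extend-with y) (splits ys)

splits-sound : ∀ xs {s} → s ∈ splits xs → IsSplit xs s
splits-sound []       (here refl) = [] , refl
splits-sound (y ∷ ys) s∈ with ∈-++⁻ (map (close-with y) (splits ys)) s∈
... | inj₁ s∈close with ∈-map⁻ (close-with y) s∈close
...   | _ , s'∈ , refl with splits-sound ys s'∈
...     | ne , eq = nonEmpty ∷ ne , cong (y ∷_) eq
splits-sound (y ∷ ys) s∈ | inj₂ s∈extend with ∈-map⁻ (extend-with y) s∈extend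
...   | _ , s'∈ , refl with splits-sound ys s'∈
...     | ne , eq = ne , cong (y ∷_) eq

-- Every split arises: look at whether the open block is empty.
splits-complete : ∀ xs b bs → IsSplit xs (b , bs) → (b , bs) ∈ splits xs
splits-complete []       []      []             _            = here refl
splits-complete []       []      ([] ∷ _)       (() ∷ _ , _)
splits-complete (y ∷ ys) (x ∷ b) bs             (ne , eq)    with ∷-injective eq
... | refl , eq' =
  ∈-++⁺ʳ (map (close-with y) (splits ys)) (∈-map⁺ (extend-with y) (splits-complete ys b bs (ne , eq')))
splits-complete (y ∷ ys) []      ((x ∷ c) ∷ cs) (_ ∷ ne , eq) with ∷-injective eq
... | refl , eq' = ∈-++⁺ˡ (∈-map⁺ (close-with y) (splits-complete ys c cs (ne , eq')))
splits-complete (y ∷ ys) []      ([] ∷ _)       (() ∷ _ , _)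

-- Each element doubles the number of splits.
splits-length : ∀ xs → length (splits xs) ≡ 2 ^ length xs
splits-length []       = refl
splits-length (y ∷ ys) = begin
  length (map (close-with y) (splits ys) ++ map (extend-with y) (splits ys))
    ≡⟨ length-++ (map (close-with y) (splits ys)) ⟩
  length (map (close-with y) (splits ys)) + length (map (extend-with y) (splits ys))
    ≡⟨ cong₂ _+_ (length-map (close-with y) (splits ys)) (length-map (extend-with y) (splits ys)) ⟩
  length (splits ys) + length (splits ys)
    ≡⟨ cong (λ k → k + k) (splits-length ys) ⟩
  2 ^ length ys + 2 ^ length ys
    ≡⟨ cong (2 ^ length ys +_) (sym (+-identityʳ (2 ^ length ys))) ⟩
  2 ^ length (y ∷ ys) ∎

-- No split is listed twice: both extensions are injective and their images
-- are disjoint (the open block is empty in one and nonempty in the other).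
splits-unique : ∀ xs → Unique (splits xs)
splits-unique []       = [] ∷ []
splits-unique (y ∷ ys) =
  Unique.++⁺ (Unique.map⁺ close-injective (splits-unique ys))
             (Unique.map⁺ extend-injective (splits-unique ys)) disjoint
  where
  close-injective : ∀ {s t} → close-with y s ≡ close-with y t → s ≡ t
  close-injective {_ , _} {_ , _} refl = refl
  extend-injective : ∀ {s t} → extend-with y s ≡ extend-with y t → s ≡ t
  extend-injective {_ , _} {_ , _} refl = refl
  disjoint : ∀ {s} → ¬ (s ∈ map (close-with y) (splits ys) × s ∈ map (extend-with y) (splits ys))
  disjoint (∈close , ∈extend) with ∈-map⁻ (close-with y) ∈close | ∈-map⁻ (extend-with y) ∈extend
  ... | _ , _ , refl | _ , _ , ()

-- Segmentations of x ∷ xs: x opens the first block, completed by a split of xs.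
seal : ℕ → Split → Blocks
seal x (b , bs) = (x ∷ b) ∷ bs

segmentations : ℕ → List ℕ → List Blocks
segmentations x xs = map (seal x) (splits xs)

segmentations-complete : ∀ x xs bs → IsSegmentation (x ∷ xs) bs → bs ∈ segmentations x xs
segmentations-complete x xs ((y ∷ b) ∷ cs) (_ ∷ ne , eq) with ∷-injective eq
... | refl , eq' = ∈-map⁺ (seal x) (splits-complete xs b cs (ne , eq'))
segmentations-complete x xs ([] ∷ _) (() ∷ _ , _)

∈-segmentations : ∀ x xs bs → (bs ∈ segmentations x xs) ⇔ IsSegmentation (x ∷ xs) bs
∈-segmentations x xs bs = mk⇔ sound (segmentations-complete x xs bs)
  where
  sound : bs ∈ segmentations x xs → IsSegmentation (x ∷ xs) bs
  sound bs∈ with ∈-map⁻ (seal x) bs∈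
  ... | _ , s∈ , refl with splits-sound xs s∈
  ...   | ne , eq = nonEmpty ∷ ne , cong (x ∷_) eq

segmentations-unique : ∀ x xs → Unique (segmentations x xs)
segmentations-unique x xs = Unique.map⁺ seal-injective (splits-unique xs)
  where
  seal-injective : ∀ {s t} → seal x s ≡ seal x t → s ≡ t
  seal-injective {_ , _} {_ , _} refl = refl

segmentations-length : ∀ x xs → length (segmentations x xs) ≡ 2 ^ length xs
segmentations-length x xs = trans (length-map (seal x) (splits xs)) (splits-length xs)

avoiding⇔segmentation : ∀ n bs →
  (IsStdPartition n bs × Avoids (flatten bs) pattern132) ⇔ IsSegmentation (oneTo n) bs
avoiding⇔segmentation n bs =
  mk⇔ (λ (std , avoids) → avoiding⇒segmentation n bs std avoids)
      (segmentation⇒avoiding n bs)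

-- 2 3 … (m+1), the tail of oneTo (suc m).
twoTo : ℕ → List ℕ
twoTo m = map suc (applyUpTo suc m)

length-twoTo : ∀ m → length (twoTo m) ≡ m
length-twoTo m = trans (length-map suc (applyUpTo suc m)) (length-applyUpTo suc m)

mainTheorem2 : (n : ℕ) → 1 ≤ n →
    Σ (List Blocks) λ L →
      Unique L ×
      (∀ bs → (bs ∈ L) ⇔ (IsStdPartition n bs × Avoids (flatten bs) pattern132)) ×
      length L ≡ 2 ^ (n ∸ 1)
mainTheorem2 (suc m) _ =
  segmentations 1 (twoTo m) ,
  segmentations-unique 1 (twoTo m) ,
  (λ bs → ⇔-trans (∈-segmentations 1 (twoTo m) bs) (⇔-sym (avoiding⇔segmentation (suc m) bs))) ,
  (begin
    length (segmentations 1 (twoTo m)) ≡⟨ segmentations-length 1 (twoTo m) ⟩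
    2 ^ length (twoTo m)               ≡⟨ cong (2 ^_) (length-twoTo m) ⟩
    2 ^ m                              ∎)
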